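{- Let $G$ be an infinite group and let $W\subseteq G$. (1) If $W$ is finite and nonempty, then no asymptotic complement of $W$ in $G$ contains a minimal asymptotic complement of $W$, and $W$ does not admit any minimal asymptotic complement in $G$. (2) If $G\setminus W$ is finite and nonempty, then $W$ admits a minimal complement in $G$ of cardinality two, and the singleton subsets of $G$ are precisely the minimal asymptotic complements of $W$ in $G$.
   Context: For nonempty subsets $A,B$ of a group $G$, $AB=\{ab : a\in A, b\in B\}$. Given nonempty $W,C\subseteq G$: $C$ is a complement to $W$ if $WC=G$; $C$ is a minimal complement to $W$ if $C$ is a complement to $W$ but $C\setminus\{c\}$ is not a complement to $W$ for every $c\in C$. $C$ is an asymptotic complement to $W$ if there is a finite subset $F\subseteq G$ with $WC=G\setminus F$; $C$ is a minimal asymptotic complement to $W$ if $C$ is an asymptotic complement to $W$ but $C\setminus\{c\}$ is not an asymptotic complement to $W$ for every $c\in C$. -}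

module Defs where

open import Level using (Level; suc)
open import Algebra.Bundles using (Group)
open import Data.Product using (Σ; ∃; ∃₂; _×_; _,_)
open import Data.Sum using (_⊎_)
open import Data.List using (List)
open import Data.List.Relation.Unary.Any using (Any)
open import Relation.Nullary using (¬_)
open import Function.Bundles using (_⇔_)

module _ {ℓ : Level} (G : Group ℓ ℓ) where
  open Group G

  record Subset : Set (suc ℓ) where
    constructor subset
    field
      mem  : Carrier → Set ℓ
      resp : ∀ {x y} → x ≈ y → mem x → mem y
  open Subset public

  _∈L_ : Carrier → List Carrier → Set ℓ
  x ∈L L = Any (x ≈_) L

  Nonempty : Subset → Set ℓ
  Nonempty A = ∃ λ x → mem A x

  IsFinite : Subset → Set ℓ
  IsFinite A = ∃ λ (L : List Carrier) → ∀ x → (mem A x ⇔ x ∈L L)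

  Infinite : Set ℓ
  Infinite = ¬ (∃ λ (L : List Carrier) → ∀ x → x ∈L L)

  compl : Subset → Subset
  compl A = subset (λ x → ¬ mem A x) (λ x≈y ¬Ax Ay → ¬Ax (resp A (sym x≈y) Ay))

  remove : Subset → Carrier → Subset
  remove C c = subset (λ x → mem C x × ¬ (x ≈ c))
    (λ x≈y (Cx , x≉c) → resp C x≈y Cx , λ y≈c → x≉c (trans x≈y y≈c))

  singleton : Carrier → Subset
  singleton g = subset (λ x → x ≈ g) (λ x≈y x≈g → trans (sym x≈y) x≈g)

  _⊆_ : Subset → Subset → Set ℓ
  A ⊆ B = ∀ x → mem A x → mem B x

  _≐_ : Subset → Subset → Set ℓ
  A ≐ B = ∀ x → (mem A x ⇔ mem B x)

  InProduct : Subset → Subset → Carrier → Set ℓ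
  InProduct W C g = ∃₂ λ w c → mem W w × mem C c × (g ≈ w ∙ c)

  IsComplement : Subset → Subset → Set ℓ
  IsComplement W C = Nonempty C × (∀ g → InProduct W C g)

  IsMinimalComplement : Subset → Subset → Set ℓ
  IsMinimalComplement W C =
    IsComplement W C × (∀ c → mem C c → ¬ IsComplement W (remove C c))

  IsAsymptoticComplement : Subset → Subset → Set ℓ
  IsAsymptoticComplement W C =
    Nonempty C × (∃ λ (F : List Carrier) → ∀ g → (InProduct W C g ⇔ (¬ (g ∈L F))))

  IsMinimalAsymptoticComplement : Subset → Subset → Set ℓ
  IsMinimalAsymptoticComplement W C =
    IsAsymptoticComplement W C × (∀ c → mem C c → ¬ IsAsymptoticComplement W (remove C c))

  HasCardinalityTwo : Subset → Set ℓ
  HasCardinalityTwo C = ∃₂ λ a b → ¬ (a ≈ b) × (∀ x → (mem C x ⇔ (x ≈ a ⊎ x ≈ b)))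

module Submission where

-- The central notion is "W D covers everything outside a finite list L".  Such
-- a D is an asymptotic complement as soon as it is nonempty (the exceptional
-- set is the part of L that W D misses), and in an infinite group it is
-- automatically nonempty.
--
-- (1) W finite.  If W C misses only the finite set F, then for c ∈ C the set
--     W (C ∖ {c}) still contains everything outside F ∪ W c; hence no
--     asymptotic complement is minimal.
-- (2) W cofinite, X = G ∖ W.  Any right translate W c misses only X c, so every
--     set containing an element is an asymptotic complement: the minimal ones
--     are exactly the singletons.  No subset of a singleton {a} is a complement
--     (z a ∉ W a for z ∉ W), while {ε, b} is one for any b ∉ X⁻¹X: if g ∉ W and
--     g b⁻¹ ∉ W then b = (g b⁻¹)⁻¹ g ∈ X⁻¹X.  So {ε, b} is a minimal complement.

open import Defs
open import Level using (Level)
open import Algebra.Bundles using (Group)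
open import Axiom.ExcludedMiddle using (ExcludedMiddle)
open import Axiom.DoubleNegationElimination using (em⇒dne)
open import Data.Product using (∃; _×_; _,_; proj₁; proj₂)
open import Data.Sum using (_⊎_; inj₁; inj₂)
open import Data.Empty using (⊥-elim)
open import Data.List using (List; _++_; map; filter; cartesianProductWith)
open import Relation.Nullary using (¬_; Dec; yes; no)
open import Function.Bundles using (_⇔_; mk⇔; Equivalence)
import Algebra.Properties.Group as GroupProperties
import Data.List.Membership.Setoid as Membership
import Data.List.Membership.Setoid.Properties as MembershipProperties
import Relation.Binary.Reasoning.Setoid as SetoidReasoning

module Complements {ℓ : Level} (em : ExcludedMiddle ℓ) (G : Group ℓ ℓ) where
  open Group G
  open GroupProperties G using (//-rightDividesˡ; //-rightDividesʳ; \\-leftDividesʳ; \\-cong₂)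
  open Membership setoid using (_∈_; _∉_)
  open MembershipProperties using (∈-resp-≈; ∈-map⁺; ∈-++⁺ˡ; ∈-++⁺ʳ; ∈-filter⁺; ∈-filter⁻;
                                   ∈-cartesianProductWith⁺)
  open SetoidReasoning setoid

  dne : ∀ {P : Set ℓ} → ¬ ¬ P → P
  dne = em⇒dne em

  ∈-translate : ∀ {x} c {L : List Carrier} → x ∈ L → x ∙ c ∈ map (_∙ c) L
  ∈-translate c = ∈-map⁺ setoid setoid ∙-congʳ

  fresh : Infinite G → (L : List Carrier) → ∃ λ x → x ∉ L
  fresh infinite L = dne λ noneOutside →
    infinite (L , λ x → dne λ x∉L → noneOutside (x , x∉L))

  inProduct-resp : ∀ W D {x y} → x ≈ y → InProduct G W D x → InProduct G W D y
  inProduct-resp W D x≈y (w , d , w∈W , d∈D , x≈wd) = w , d , w∈W , d∈D , trans (sym x≈y) x≈wd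

  CoversOutside : Subset G → Subset G → List Carrier → Set ℓ
  CoversOutside W D L = ∀ g → g ∉ L → InProduct G W D g

  -- A nonempty D covering all but finitely many elements is an asymptotic
  -- complement; the exceptional set is the sublist of L missed by W D.
  coversOutside⇒asymptotic : ∀ W D L → Nonempty G D → CoversOutside W D L →
                             IsAsymptoticComplement G W D
  coversOutside⇒asymptotic W D L nonempty covers =
    nonempty , missed , λ g → mk⇔ (covered⇒∉missed g) (∉missed⇒covered g)
    where
    Missed : Carrier → Set ℓ
    Missed g = ¬ InProduct G W D g

    missed-resp : ∀ {x y} → x ≈ y → Missed x → Missed y
    missed-resp x≈y ¬Px Py = ¬Px (inProduct-resp W D (sym x≈y) Py)

    missed? : ∀ g → Dec (Missed g)
    missed? _ = em

    missed : List Carrier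
    missed = filter missed? L

    covered⇒∉missed : ∀ g → InProduct G W D g → g ∉ missed
    covered⇒∉missed g Pg g∈missed = proj₂ (∈-filter⁻ setoid missed? missed-resp {xs = L} g∈missed) Pg

    ∉missed⇒covered : ∀ g → g ∉ missed → InProduct G W D g
    ∉missed⇒covered g g∉missed = dne λ ¬Pg →
      g∉missed (∈-filter⁺ setoid missed? missed-resp (dne λ g∉L → ¬Pg (covers g g∉L)) ¬Pg)

  coversOutside⇒nonempty : Infinite G → ∀ W D L → CoversOutside W D L → Nonempty G D
  coversOutside⇒nonempty infinite W D L covers
    with fresh infinite L
  ... | g , g∉L with covers g g∉L
  ...   | _ , d , _ , d∈D , _ = d , d∈D

  -- Removing one element c from an asymptotic complement loses at most W c.
  remove-coversOutside : ∀ W C {LW} → (∀ x → mem W x ⇔ x ∈ LW) →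
    ∀ F → (∀ g → InProduct G W C g ⇔ g ∉ F) →
    ∀ c → CoversOutside W (remove G C c) (F ++ map (_∙ c) LW)
  remove-coversOutside W C {LW} listW F exceptional c g g∉
    with Equivalence.from (exceptional g) (λ g∈F → g∉ (∈-++⁺ˡ setoid g∈F))
  ... | w , c′ , w∈W , c′∈C , g≈wc′ = w , c′ , w∈W , (c′∈C , c′≉c) , g≈wc′
    where
    c′≉c : ¬ c′ ≈ c
    c′≉c c′≈c = g∉ (∈-++⁺ʳ setoid F (∈-resp-≈ setoid (sym (trans g≈wc′ (∙-congˡ c′≈c)))
                                     (∈-translate c (Equivalence.to (listW w) w∈W))))

  finite⇒noMinimalAsymptotic : Infinite G → ∀ W → IsFinite G W →
                               ∀ C → ¬ IsMinimalAsymptoticComplement G W C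
  finite⇒noMinimalAsymptotic infinite W (LW , listW) C (((c , c∈C) , F , exceptional) , minimal) =
    minimal c c∈C (coversOutside⇒asymptotic W D L (coversOutside⇒nonempty infinite W D L covers) covers)
    where
    D : Subset G
    D = remove G C c

    L : List Carrier
    L = F ++ map (_∙ c) LW

    covers : CoversOutside W D L
    covers = remove-coversOutside W C listW F exceptional c

  pair : Carrier → Carrier → Subset G
  pair a b = subset (λ x → x ≈ a ⊎ x ≈ b)
    (λ { x≈y (inj₁ x≈a) → inj₁ (trans (sym x≈y) x≈a) ; x≈y (inj₂ x≈b) → inj₂ (trans (sym x≈y) x≈b) })

  subsingleton⇒notComplement : ∀ W z → ¬ mem W z → ∀ D a → (∀ x → mem D x → x ≈ a) →
                               ¬ IsComplement G W D
  subsingleton⇒notComplement W z z∉W D a inSingleton (_ , covers)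
    with covers (z ∙ a)
  ... | w , d , w∈W , d∈D , za≈wd = z∉W (resp W (sym z≈w) w∈W)
    where
    z≈w : z ≈ w
    z≈w = begin
      z             ≈⟨ //-rightDividesʳ a z ⟨
      (z ∙ a) // a  ≈⟨ ∙-congʳ za≈wd ⟩
      (w ∙ d) // a  ≈⟨ ∙-congʳ (∙-congˡ (inSingleton d d∈D)) ⟩
      (w ∙ a) // a  ≈⟨ //-rightDividesʳ a w ⟩
      w             ∎

  module Cofinite (W : Subset G) (LX : List Carrier)
                  (listX : ∀ x → mem (compl G W) x ⇔ x ∈ LX) where

    outside⇒listed : ∀ x → ¬ mem W x → x ∈ LX
    outside⇒listed x = Equivalence.to (listX x)

    translate-coversOutside : ∀ D c → mem D c → CoversOutside W D (map (_∙ c) LX)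
    translate-coversOutside D c c∈D g g∉Xc = g // c , c , g/c∈W , c∈D , sym (//-rightDividesˡ c g)
      where
      g/c∈W : mem W (g // c)
      g/c∈W = dne λ g/c∉W → g∉Xc (∈-resp-≈ setoid (//-rightDividesˡ c g)
                                   (∈-translate c (outside⇒listed (g // c) g/c∉W)))

    inhabited⇒asymptotic : ∀ D c → mem D c → IsAsymptoticComplement G W D
    inhabited⇒asymptotic D c c∈D =
      coversOutside⇒asymptotic W D (map (_∙ c) LX) (c , c∈D) (translate-coversOutside D c c∈D)

    singleton⇒minimalAsymptotic : ∀ C g → _≐_ G C (singleton G g) →
                                  IsMinimalAsymptoticComplement G W C
    singleton⇒minimalAsymptotic C g C≐g = inhabited⇒asymptotic C g g∈C , removeEmpties
      where
      g∈C : mem C g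
      g∈C = Equivalence.from (C≐g g) refl

      removeEmpties : ∀ c → mem C c → ¬ IsAsymptoticComplement G W (remove G C c)
      removeEmpties c c∈C ((x , x∈C , x≉c) , _) =
        x≉c (trans (Equivalence.to (C≐g x) x∈C) (sym (Equivalence.to (C≐g c) c∈C)))

    minimalAsymptotic⇒singleton : ∀ C → IsMinimalAsymptoticComplement G W C →
                                  ∃ λ g → _≐_ G C (singleton G g)
    minimalAsymptotic⇒singleton C (((c , c∈C) , _) , minimal) =
      c , λ x → mk⇔ (onlyC x) (λ x≈c → resp C (sym x≈c) c∈C)
      where
      onlyC : ∀ x → mem C x → x ≈ c
      onlyC x x∈C = dne λ x≉c →
        minimal x x∈C (inhabited⇒asymptotic (remove G C x) c (c∈C , λ c≈x → x≉c (sym c≈x)))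

    quotients : List Carrier
    quotients = cartesianProductWith _\\_ LX LX

    twoElementComplement : ∀ b → b ∉ quotients → ∀ g → InProduct G W (pair ε b) g
    twoElementComplement b b∉X⁻¹X g with em {mem W g} | em {mem W (g // b)}
    ... | yes g∈W | _ = g , ε , g∈W , inj₁ refl , sym (identityʳ g)
    ... | no _ | yes g/b∈W = g // b , b , g/b∈W , inj₂ refl , sym (//-rightDividesˡ b g)
    ... | no g∉W | no g/b∉W = ⊥-elim (b∉X⁻¹X (∈-resp-≈ setoid quotient≈b
          (∈-cartesianProductWith⁺ setoid setoid setoid \\-cong₂
             (outside⇒listed (g // b) g/b∉W) (outside⇒listed g g∉W))))
      where
      quotient≈b : (g // b) \\ g ≈ b
      quotient≈b = begin
        (g // b) \\ g              ≈⟨ \\-cong₂ refl (//-rightDividesˡ b g) ⟨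
        (g // b) \\ ((g // b) ∙ b) ≈⟨ \\-leftDividesʳ (g // b) b ⟩
        b                          ∎

    -- If W ≠ G, then {ε, b} with b ∉ X⁻¹X is a minimal complement of size two.
    minimalComplementOfSizeTwo : Infinite G → ∀ z → ¬ mem W z →
      ∃ λ C → IsMinimalComplement G W C × HasCardinalityTwo G C
    minimalComplementOfSizeTwo infinite z z∉W =
      pair ε b , (((ε , inj₁ refl) , twoElementComplement b b∉X⁻¹X) , removeBreaks) ,
      (ε , b , ε≉b , λ x → mk⇔ (λ p → p) (λ p → p))
      where
      b = proj₁ (fresh infinite quotients)
      b∉X⁻¹X = proj₂ (fresh infinite quotients)

      ε≉b : ¬ ε ≈ b
      ε≉b ε≈b = b∉X⁻¹X (∈-resp-≈ setoid (trans (inverseˡ z) ε≈b)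
        (∈-cartesianProductWith⁺ setoid setoid setoid \\-cong₂
          (outside⇒listed z z∉W) (outside⇒listed z z∉W)))

      notComplement : ∀ D a → (∀ x → mem D x → x ≈ a) → ¬ IsComplement G W D
      notComplement = subsingleton⇒notComplement W z z∉W

      removeBreaks : ∀ c → mem (pair ε b) c → ¬ IsComplement G W (remove G (pair ε b) c)
      removeBreaks c (inj₁ c≈ε) = notComplement (remove G (pair ε b) c) b λ
        { x (inj₁ x≈ε , x≉c) → ⊥-elim (x≉c (trans x≈ε (sym c≈ε))) ; x (inj₂ x≈b , _) → x≈b }
      removeBreaks c (inj₂ c≈b) = notComplement (remove G (pair ε b) c) ε λ
        { x (inj₁ x≈ε , _) → x≈ε ; x (inj₂ x≈b , x≉c) → ⊥-elim (x≉c (trans x≈b (sym c≈b))) }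

theoremA : ∀ {ℓ : Level} → ExcludedMiddle ℓ → (G : Group ℓ ℓ) → Infinite G → (W : Subset G) →
    ((IsFinite G W × Nonempty G W) →
    ((∀ C → IsAsymptoticComplement G W C →
    ¬ (∃ λ C′ → _⊆_ G C′ C × IsMinimalAsymptoticComplement G W C′))
    × ¬ (∃ λ C → IsMinimalAsymptoticComplement G W C)))
    × ((IsFinite G (compl G W) × Nonempty G (compl G W)) →
    ((∃ λ C → IsMinimalComplement G W C × HasCardinalityTwo G C)
    × (∀ C → (IsMinimalAsymptoticComplement G W C ⇔ (∃ λ g → _≐_ G C (singleton G g))))))
theoremA em G infinite W =
  (λ { (finite , _) →
       (λ _ _ (C′ , _ , minimal) → noMinimal finite C′ minimal) ,
       (λ (C , minimal) → noMinimal finite C minimal) }) ,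
  (λ { ((LX , listX) , (z , z∉W)) →
       let open Cofinite W LX listX in
       minimalComplementOfSizeTwo infinite z z∉W ,
       λ C → mk⇔ (minimalAsymptotic⇒singleton C) (λ (g , C≐g) → singleton⇒minimalAsymptotic C g C≐g) })
  where
  open Complements em G

  noMinimal : IsFinite G W → ∀ C → ¬ IsMinimalAsymptoticComplement G W C
  noMinimal = finite⇒noMinimalAsymptotic infinite W
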